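{- Let $G$ be a graph in which either all vertices have odd degree or all vertices have even degree, and let $\Gamma$ be an Abelian group containing at least one nonzero involution. Then $G$ is $\Gamma$-vertex magic. In addition, if $G$ is regular then $G$ is group vertex magic.
   Context: Graphs are finite, simple and undirected. For an additive Abelian group $\Gamma$ with identity $0$ and a graph $G$, a $\Gamma$-vertex magic labeling is a map $\ell:V(G)\to\Gamma\setminus\{0\}$ for which there is $\mu\in\Gamma$ with $w(v)=\sum_{u\in N(v)}\ell(u)=\mu$ for every vertex $v$; $G$ is $\Gamma$-vertex magic if it has such a labeling, and group vertex magic if it is $\Gamma$-vertex magic for every nontrivial Abelian group $\Gamma$. An element $g$ is an involution if $g=-g$. -}

module Defs where

open import Level using (Level; _⊔_; Setω)
open import Data.Nat using (ℕ; zero; suc; _%_)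
open import Data.Bool using (Bool; true; false; if_then_else_)
open import Data.Fin using (Fin)
open import Data.List using (List; foldr; allFin)
open import Data.Product using (Σ; ∃; _×_; _,_)
open import Data.Sum using (_⊎_)
open import Relation.Nullary using (¬_)
open import Relation.Binary.PropositionalEquality using (_≡_)
open import Algebra.Bundles using (AbelianGroup)

record Graph (n : ℕ) : Set where
  field
    adj     : Fin n → Fin n → Bool
    adj-sym : ∀ u v → adj u v ≡ adj v u
    adj-irr : ∀ v → adj v v ≡ false

open Graph public

degree : ∀ {n} → Graph n → Fin n → ℕ
degree {n} G v = foldr (λ u acc → if adj G v u then suc acc else acc) zero (allFin n)

Odd : ℕ → Set
Odd k = k % 2 ≡ 1

Even : ℕ → Set
Even k = k % 2 ≡ 0

AllOddOrAllEven : ∀ {n} → Graph n → Set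
AllOddOrAllEven {n} G = (∀ v → Odd (degree G v)) ⊎ (∀ v → Even (degree G v))

Regular : ∀ {n} → Graph n → Set
Regular {n} G = ∃ λ r → ∀ v → degree G v ≡ r

module _ {c ℓ : Level} (Γ : AbelianGroup c ℓ) where
  open AbelianGroup Γ renaming (Carrier to A)

  weight : ∀ {n} → Graph n → (Fin n → A) → Fin n → A
  weight {n} G lab v = foldr (λ u acc → if adj G v u then lab u ∙ acc else acc) ε (allFin n)

  IsVertexMagicLabeling : ∀ {n} → Graph n → (Fin n → A) → Set (c ⊔ ℓ)
  IsVertexMagicLabeling {n} G lab =
    (∀ v → ¬ (lab v ≈ ε)) × Σ A (λ μ → ∀ v → weight G lab v ≈ μ)

  VertexMagic : ∀ {n} → Graph n → Set (c ⊔ ℓ)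
  VertexMagic {n} G = Σ (Fin n → A) (IsVertexMagicLabeling G)

  Nontrivial : Set (c ⊔ ℓ)
  Nontrivial = Σ A (λ g → ¬ (g ≈ ε))

  -- g is an involution iff g = -g
  HasNonzeroInvolution : Set (c ⊔ ℓ)
  HasNonzeroInvolution = Σ A (λ g → ¬ (g ≈ ε) × g ≈ (g ⁻¹))

GroupVertexMagic : ∀ {n} → Graph n → Setω
GroupVertexMagic G = ∀ {c ℓ} (Γ : AbelianGroup c ℓ) → Nontrivial Γ → VertexMagic Γ G

record _×ω_ (P Q : Setω) : Setω where
  constructor _,ω_
  field
    fstω : P
    sndω : Q

{-# OPTIONS --safe #-}

-- Label every vertex with the same nonzero g. The weight of v is then deg(v)·g,
-- which is constant when G is regular; and when g is an involution, 2·g = 0,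
-- so deg(v)·g only depends on the parity of deg(v).
module Submission where

open import Defs
open import Data.Nat using (ℕ; zero; suc; NonZero; _+_; _%_; _/_; _*_)
open import Data.Nat.DivMod using (m≡m%n+[m/n]*n)
open import Data.Bool using (true; false; if_then_else_)
open import Data.List using ([]; _∷_; foldr; allFin)
open import Data.Product using (∃; _,_)
open import Data.Sum using (inj₁; inj₂)
open import Relation.Nullary using (¬_)
open import Relation.Binary.PropositionalEquality as ≡ using (_≡_)
open import Algebra.Bundles using (AbelianGroup)
import Algebra.Properties.Monoid.Mult as MonoidMult
import Relation.Binary.Reasoning.Setoid as SetoidReasoning

degrees-share-parity : ∀ {n} (G : Graph n) → AllOddOrAllEven G →
  ∃ λ p → ∀ v → degree G v % 2 ≡ p
degrees-share-parity G (inj₁ odd)  = 1 , odd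
degrees-share-parity G (inj₂ even) = 0 , even

module _ {c ℓ} (Γ : AbelianGroup c ℓ) where
  open AbelianGroup Γ renaming (Carrier to A)
  open MonoidMult monoid using (_×_; ×-congˡ; ×-congʳ; ×-homo-+; ×-assocˡ)
  open SetoidReasoning setoid

  ×-zeroʳ : ∀ k → k × ε ≈ ε
  ×-zeroʳ zero    = refl
  ×-zeroʳ (suc k) = trans (identityˡ (k × ε)) (×-zeroʳ k)

  ×-mod : ∀ {g} m .{{_ : NonZero m}} → m × g ≈ ε → ∀ k → k × g ≈ (k % m) × g
  ×-mod {g} m m×g≈ε k = begin
    k × g                              ≈⟨ ×-congˡ (m≡m%n+[m/n]*n k m) ⟩
    (k % m + (k / m) * m) × g          ≈⟨ ×-homo-+ g (k % m) ((k / m) * m) ⟩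
    (k % m) × g ∙ ((k / m) * m) × g    ≈⟨ ∙-congˡ (sym (×-assocˡ g (k / m) m)) ⟩
    (k % m) × g ∙ (k / m) × (m × g)    ≈⟨ ∙-congˡ (×-congʳ (k / m) m×g≈ε) ⟩
    (k % m) × g ∙ (k / m) × ε          ≈⟨ ∙-congˡ (×-zeroʳ (k / m)) ⟩
    (k % m) × g ∙ ε                    ≈⟨ identityʳ ((k % m) × g) ⟩
    (k % m) × g                        ∎

  involution⇒2×≈ε : ∀ {g} → g ≈ g ⁻¹ → 2 × g ≈ ε
  involution⇒2×≈ε {g} g≈g⁻¹ = begin
    g ∙ (g ∙ ε)  ≈⟨ ∙-congˡ (identityʳ g) ⟩
    g ∙ g        ≈⟨ ∙-congˡ g≈g⁻¹ ⟩
    g ∙ g ⁻¹     ≈⟨ inverseʳ g ⟩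
    ε            ∎

  weight-const : ∀ {n} (G : Graph n) g v → weight Γ G (λ _ → g) v ≈ degree G v × g
  weight-const {n} G g v = go (allFin n)
    where
    go : ∀ us →
      foldr (λ u acc → if adj G v u then g ∙ acc else acc) ε us
        ≈ foldr (λ u k → if adj G v u then suc k else k) zero us × g
    go []       = refl
    go (u ∷ us) with adj G v u
    ... | true  = ∙-congˡ (go us)
    ... | false = go us

  const-vertexMagic : ∀ {n} (G : Graph n) {g} → ¬ (g ≈ ε) →
    ∀ μ → (∀ v → degree G v × g ≈ μ) → VertexMagic Γ G
  const-vertexMagic G {g} g≉ε μ deg×g≈μ =
    (λ _ → g) , (λ _ → g≉ε) , μ , λ v → trans (weight-const G g v) (deg×g≈μ v)

  vertexMagic-of-parity : ∀ {n} (G : Graph n) → AllOddOrAllEven G →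
    HasNonzeroInvolution Γ → VertexMagic Γ G
  vertexMagic-of-parity G parity (g , g≉ε , g≈g⁻¹) with degrees-share-parity G parity
  ... | p , deg%2≡p = const-vertexMagic G g≉ε (p × g) λ v →
    trans (×-mod 2 (involution⇒2×≈ε g≈g⁻¹) (degree G v)) (reflexive (≡.cong (_× g) (deg%2≡p v)))

  vertexMagic-of-regular : ∀ {n} (G : Graph n) → Regular G → Nontrivial Γ → VertexMagic Γ G
  vertexMagic-of-regular G (r , deg≡r) (g , g≉ε) =
    const-vertexMagic G g≉ε (r × g) λ v → ×-congˡ (deg≡r v)

proposition3p1 : (n : ℕ) (G : Graph n) →
    ((∀ {c ℓ} (Γ : AbelianGroup c ℓ) → AllOddOrAllEven G → HasNonzeroInvolution Γ → VertexMagic Γ G)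
    ×ω (Regular G → GroupVertexMagic G))
proposition3p1 n G =
  (λ Γ → vertexMagic-of-parity Γ G) ,ω (λ regular Γ → vertexMagic-of-regular Γ G regular)
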